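{- Let $\Gamma$ be a nonempty finite set, let $A\subseteq\Gamma$ be non-trivial (i.e. $A\neq\emptyset$ and $A\neq\Gamma$), and let $\mathcal B\subseteq\mathcal P(\Gamma)$ be a non-empty family of sets. Then $\rho(A,\mathcal B)=D^\circ_\cap(A\mid\mathcal B)$.
   Context: Cover complexity: let $U=\Gamma\setminus A$. A semi-filter over $U$ is a nonempty family $\mathcal F\subseteq\mathcal P(U)$ with $\emptyset\notin\mathcal F$ such that $U_1\in\mathcal F$ and $U_1\subseteq U_2\subseteq U$ imply $U_2\in\mathcal F$. $\mathcal F$ is above $w\in\Gamma$ (w.r.t. $\mathcal B$ and $U$) if for every $B\in\mathcal B$ with $w\in B$ we have $B\cap U\in\mathcal F$. $\mathcal F$ preserves a pair $(E,H)$ of subsets of $U$ if $E,H\in\mathcal F$ imply $E\cap H\in\mathcal F$; it preserves a collection $\Lambda$ if it preserves each pair. $\rho(A,\mathcal B)$ is the minimum size of a collection $\Lambda$ of pairs of subsets of $U$ such that no semi-filter over $U$ that preserves $\Lambda$ is above some $a\in A$ ($\infty$ if none exists). Cyclic intersection complexity: a syntactic sequence is a list of formal symbols $I_1,\dots,I_t$ together with, for each $i\in[t]$, an operation $I_i=K_{i_1}\star_iK_{i_2}$ with $K_{i_1},K_{i_2}\in\{I_1,\dots,I_t\}\cup\mathcal B$ and $\star_i\in\{\cap,\cup\}$ (no ordering requirement, so cycles are allowed). It is evaluated by setting $I_i^0=\emptyset$ for all $i$ and, for $j>0$, $I_i^j=I_i^{j-1}\cup(K_{i_1}^{j-1}\star_iK_{i_2}^{j-1})$,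 where each generator $B\in\mathcal B$ has value $B$ at every stage. It generates $A$ from $\mathcal B$ if there is $j_0$ with $I_t^{j}=A$ for all $j\ge j_0$. $D^\circ_\cap(A\mid\mathcal B)$ is the minimum number of indices $i$ with $\star_i=\cap$ over all syntactic sequences generating $A$ from $\mathcal B$ ($\infty$ if none). -}

module Defs where

open import Data.Nat using (ℕ; zero; suc; _+_; _≤_; _<_; _≥_)
open import Data.Bool using (Bool; true; false; if_then_else_)
open import Data.Fin using (Fin; fromℕ)
import Data.Fin as F
open import Data.Fin.Subset using (Subset; ⊥; ⊤; ∁; _∩_; _∪_; _⊆_; _∈_)
open import Data.List using (List; length; lookup)
open import Data.List.Membership.Propositional using () renaming (_∈_ to _∈ₗ_)
open import Data.List.Relation.Unary.All using (All)
open import Data.Product using (Σ; ∃; _×_; _,_; proj₁; proj₂)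
open import Data.Sum using (_⊎_; inj₁; inj₂)
open import Relation.Binary.PropositionalEquality using (_≡_; _≢_)
open import Relation.Nullary using (¬_)

-- Γ is modelled as Fin n; subsets of Γ as Subset n (characteristic vectors).
-- A family 𝓑 ⊆ P(Γ) is modelled as a list of subsets (duplicates irrelevant).

U : ∀ {n} → Subset n → Subset n
U A = ∁ A

Family : ℕ → Set
Family n = Subset n → Bool

record IsSemiFilter {n : ℕ} (Uₛ : Subset n) (𝓕 : Family n) : Set where
  field
    within    : ∀ X → 𝓕 X ≡ true → X ⊆ Uₛ
    nonempty  : ∃ λ X → 𝓕 X ≡ true
    noEmpty   : 𝓕 ⊥ ≡ false
    upward    : ∀ X Y → 𝓕 X ≡ true → X ⊆ Y → Y ⊆ Uₛ → 𝓕 Y ≡ true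

Above : ∀ {n} → List (Subset n) → Subset n → Family n → Fin n → Set
Above 𝓑 Uₛ 𝓕 w = ∀ B → B ∈ₗ 𝓑 → w ∈ B → 𝓕 (B ∩ Uₛ) ≡ true

PreservesPair : ∀ {n} → Family n → Subset n × Subset n → Set
PreservesPair 𝓕 (E , H) = 𝓕 E ≡ true → 𝓕 H ≡ true → 𝓕 (E ∩ H) ≡ true

Preserves : ∀ {n} → Family n → List (Subset n × Subset n) → Set
Preserves 𝓕 Λ = All (PreservesPair 𝓕) Λ

IsRhoWitness : ∀ {n} → Subset n → List (Subset n) → List (Subset n × Subset n) → Set
IsRhoWitness {n} A 𝓑 Λ =
  All (λ p → proj₁ p ⊆ U A × proj₂ p ⊆ U A) Λ ×
  (∀ (𝓕 : Family n) → IsSemiFilter (U A) 𝓕 → Preserves 𝓕 Λ →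
     ∀ a → a ∈ A → ¬ Above 𝓑 (U A) 𝓕 a)

-- ρ(A,𝓑) ≤ k  (as an element of ℕ ∪ {∞})
RhoAtMost : ∀ {n} → Subset n → List (Subset n) → ℕ → Set
RhoAtMost A 𝓑 k = ∃ λ Λ → length Λ ≤ k × IsRhoWitness A 𝓑 Λ

data BinOp : Set where
  cap cup : BinOp

-- A syntactic sequence with t symbols I_1..I_t over m generators
-- (the generators are the entries of the list 𝓑, m = length 𝓑).
-- An operand is either a symbol I_k (inj₁) or a generator (inj₂).
record Gate (t m : ℕ) : Set where
  constructor gate
  field
    left  : Fin t ⊎ Fin m
    op    : BinOp
    right : Fin t ⊎ Fin m

SynSeq : ℕ → ℕ → Set
SynSeq t m = Fin t → Gate t m

applyOp : ∀ {n} → BinOp → Subset n → Subset n → Subset n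
applyOp cap X Y = X ∩ Y
applyOp cup X Y = X ∪ Y

operandValue : ∀ {n t} (𝓑 : List (Subset n)) → (Fin t → Subset n) →
               Fin t ⊎ Fin (length 𝓑) → Subset n
operandValue 𝓑 I (inj₁ k) = I k
operandValue 𝓑 I (inj₂ b) = lookup 𝓑 b

eval : ∀ {n t} (𝓑 : List (Subset n)) → SynSeq t (length 𝓑) → ℕ → Fin t → Subset n
eval 𝓑 S zero    i = ⊥
eval 𝓑 S (suc j) i =
  eval 𝓑 S j i ∪ applyOp (Gate.op (S i))
                         (operandValue 𝓑 (eval 𝓑 S j) (Gate.left (S i)))
                         (operandValue 𝓑 (eval 𝓑 S j) (Gate.right (S i)))

Generates : ∀ {n s} (𝓑 : List (Subset n)) → SynSeq (suc s) (length 𝓑) → Subset n → Set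
Generates {s = s} 𝓑 S A = ∃ λ j₀ → ∀ j → j₀ ≤ j → eval 𝓑 S j (fromℕ s) ≡ A

isCap : BinOp → ℕ
isCap cap = 1
isCap cup = 0

countCaps : ∀ {t} → (Fin t → BinOp) → ℕ
countCaps {zero}  f = 0
countCaps {suc t} f = isCap (f F.zero) + countCaps (λ i → f (F.suc i))

capCount : ∀ {t m} → SynSeq t m → ℕ
capCount S = countCaps (λ i → Gate.op (S i))

-- D°∩(A | 𝓑) ≤ k  (as an element of ℕ ∪ {∞}); t ≥ 1 symbols, written t = suc s
DcapAtMost : ∀ {n} → Subset n → List (Subset n) → ℕ → Set
DcapAtMost A 𝓑 k =
  ∃ λ s → Σ (SynSeq (suc s) (length 𝓑)) λ S → capCount S ≤ k × Generates 𝓑 S A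

{-# OPTIONS --safe #-}
-- Evaluating a cyclic sequence is a monotone iteration on finitely many finite sets, so it reaches a
-- fixpoint V after finitely many steps.
--
-- ρ ≤ D°∩: for a sequence generating A, take the pair (V L ∩ U, V R ∩ U) for each ∩-gate L ∩ R. By
-- induction along the iteration, a semi-filter preserving these pairs and above a contains V I ∩ U
-- for every symbol I whose value contains a; at the output this set is A ∩ U = ∅.
--
-- D°∩ ≤ ρ: given a witness Λ = [(E₁ , H₁) , …], build for each target T ∈ {∅, Eₗ, Hₗ} a chain of
-- ∪-gates X_T collecting every generator B with B ∩ U ⊆ T and every ∩-gate Mₗ = X_{Eₗ} ∩ X_{Hₗ} with
-- Eₗ ∩ Hₗ ⊆ T, and output X_∅. Points of U in X_T lie in T, so X_∅ ⊆ A. If some a ∈ A were missing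
-- from X_∅, the subsets of U that are U itself or contain the trace on U of a source containing a
-- would form a semi-filter preserving Λ and above a.
module Submission where

open import Defs
open import Data.Nat using (ℕ; zero; suc; _+_; _*_; _∸_; _≤_; _<_; z≤n; s≤s)
open import Data.Nat.Properties
  using (+-0-monoid; m≤m+n; m≤n+m; ≤-trans; ≤-reflexive; <⇒≱; +-mono-≤; +-mono-<-≤; +-mono-≤-<; +-assoc; +-identityʳ;
         m∸n+n≡m)
open import Algebra.Properties.Monoid.Sum +-0-monoid using (sum)
open import Data.Bool using (true)
open import Data.Bool.Properties using () renaming (_≟_ to _≟ᵇ_)
open import Data.Empty using (⊥-elim)
open import Data.Fin using (Fin; zero; suc; fromℕ; inject₁; _↑ˡ_; _↑ʳ_; splitAt; combine; remQuot)
open import Data.Fin.Properties using (splitAt-↑ˡ; splitAt-↑ʳ; remQuot-combine; any?; all?; ¬∀⟶∃¬)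
open import Data.Fin.Relation.Unary.Top using (View; view; ‵fromℕ; ‵inject₁; view-fromℕ; view-inject₁)
open import Data.Fin.Subset using (Subset; ⊥; ⊤; _∩_; _∪_; _⊆_; _∈_; _∉_; _⊂_; ∣_∣)
open import Data.Fin.Subset.Properties
  using (∉⊥; ⊆⊤; ⊆-refl; ⊆-trans; ⊆-reflexive; ⊆-antisym; _∈?_; _⊆?_; p⊆p∪q; q⊆p∪q; x∈p∪q⁻; p∩q⊆q; x∈p∩q⁺; x∈p∩q⁻;
         ∩-inverseʳ; x∉p⇒x∈∁p; x∉∁p⇒x∈p; ∣p∣≤n; p⊆q⇒∣p∣≤∣q∣; p⊂q⇒∣p∣<∣q∣)
open import Data.Vec.Properties using (≡-dec)
open import Data.List using (List; []; _∷_; length; lookup)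
open import Data.List.Membership.Propositional using () renaming (_∈_ to _∈ₗ_)
open import Data.List.Membership.Propositional.Properties using (∈-lookup)
open import Data.List.Relation.Unary.All as All using (All; []; _∷_)
open import Data.List.Relation.Unary.Any using (here; there; index)
open import Data.List.Relation.Unary.Any.Properties using (lookup-index)
open import Data.Product using (∃; ∃-syntax; _×_; _,_; proj₁; proj₂)
open import Data.Sum using (_⊎_; inj₁; inj₂; [_,_]′)
open import Function using (_∘_; id; const)
open import Function.Bundles using (_⇔_; mk⇔)
open import Relation.Binary.Definitions using (Reflexive; Transitive)
open import Relation.Nullary using (¬_; Dec; yes; no; does; proof; contradiction)
open import Relation.Nullary.Decidable using (dec-true; dec-false; decidable-stable; _×-dec_; _⊎-dec_; _→-dec_)
open import Relation.Nullary.Reflects using (Reflects; invert)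
open import Relation.Binary.PropositionalEquality
  using (_≡_; _≢_; refl; sym; trans; cong; cong₂; subst; module ≡-Reasoning)

sum-mono-≤ : ∀ {t} {f g : Fin t → ℕ} → (∀ i → f i ≤ g i) → sum f ≤ sum g
sum-mono-≤ {zero}  _   = z≤n
sum-mono-≤ {suc t} f≤g = +-mono-≤ (f≤g zero) (sum-mono-≤ (f≤g ∘ suc))

sum-mono-< : ∀ {t} {f g : Fin t → ℕ} → (∀ i → f i ≤ g i) → ∀ i → f i < g i → sum f < sum g
sum-mono-< f≤g zero    fi<gi = +-mono-<-≤ fi<gi (sum-mono-≤ (f≤g ∘ suc))
sum-mono-< f≤g (suc i) fi<gi = +-mono-≤-< (f≤g zero) (sum-mono-< (f≤g ∘ suc) i fi<gi)

sum-≤-* : ∀ {t b} {f : Fin t → ℕ} → (∀ i → f i ≤ b) → sum f ≤ t * b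
sum-≤-* {zero}  _   = z≤n
sum-≤-* {suc t} f≤b = +-mono-≤ (f≤b zero) (sum-≤-* (f≤b ∘ suc))

bounded-growth-halts : ∀ {p} {P : ℕ → Set p} → (∀ j → Dec (P j)) → (f : ℕ → ℕ) (b : ℕ) →
                       (∀ j → f j ≤ b) → (∀ j → ¬ P j → f j < f (suc j)) → ∃ P
bounded-growth-halts {P = P} P? f b f≤b grows =
  [ id , (λ b<f → contradiction (f≤b (suc b)) (<⇒≱ b<f)) ]′ (search (suc b))
  where
  search : ∀ j → ∃ P ⊎ j ≤ f j
  search zero    = inj₂ z≤n
  search (suc j) with search j | P? j
  ... | inj₁ found | _      = inj₁ found
  ... | inj₂ _     | yes pj = inj₁ (j , pj)
  ... | inj₂ j≤fj  | no ¬pj = inj₂ (≤-trans (s≤s j≤fj) (grows j ¬pj))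

module _ {a ℓ} {X : Set a} {_≼_ : X → X → Set ℓ} (≼-refl : Reflexive _≼_) (≼-trans : Transitive _≼_) where

  stepwise-≼-last : ∀ {M} (h : Fin (suc M) → X) → (∀ q → h (inject₁ q) ≼ h (suc q)) →
                    ∀ p → h p ≼ h (fromℕ M)
  stepwise-≼-last {zero}  h step zero    = ≼-refl
  stepwise-≼-last {suc M} h step zero    = ≼-trans (step zero) (stepwise-≼-last (h ∘ suc) (step ∘ suc) zero)
  stepwise-≼-last {suc M} h step (suc p) = stepwise-≼-last (h ∘ suc) (step ∘ suc) p

⊆∧≢⇒⊂ : ∀ {n} {p q : Subset n} → p ⊆ q → p ≢ q → p ⊂ q
⊆∧≢⇒⊂ {n} {p} {q} p⊆q p≢q
  with ¬∀⟶∃¬ n (λ x → x ∈ q → x ∈ p) (λ x → x ∈? q →-dec x ∈? p)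
              (λ q⊆p → p≢q (⊆-antisym p⊆q (q⊆p _)))
... | x , q⇏p = p⊆q , x , decidable-stable (x ∈? q) (λ x∉q → q⇏p (⊥-elim ∘ x∉q)) , q⇏p ∘ const

countCaps-init-last : ∀ {s} (f : Fin (suc s) → BinOp) →
                      countCaps f ≡ countCaps (f ∘ inject₁) + isCap (f (fromℕ s))
countCaps-init-last {zero}  f = +-identityʳ (isCap (f zero))
countCaps-init-last {suc s} f = trans (cong (isCap (f zero) +_) (countCaps-init-last (f ∘ suc)))
                                      (sym (+-assoc (isCap (f zero)) _ _))

countCaps-++ : ∀ a {b} (f : Fin (a + b) → BinOp) →
               countCaps f ≡ countCaps (f ∘ (_↑ˡ b)) + countCaps (f ∘ (a ↑ʳ_))
countCaps-++ zero    f = refl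
countCaps-++ (suc a) f = trans (cong (isCap (f zero) +_) (countCaps-++ a (f ∘ suc)))
                               (sym (+-assoc (isCap (f zero)) _ _))

countCaps-cups : ∀ {t} {f : Fin t → BinOp} → (∀ i → f i ≡ cup) → countCaps f ≡ 0
countCaps-cups {zero}  _     = refl
countCaps-cups {suc t} f≡cup = cong₂ _+_ (cong isCap (f≡cup zero)) (countCaps-cups (f≡cup ∘ suc))

countCaps-caps : ∀ {t} {f : Fin t → BinOp} → (∀ i → f i ≡ cap) → countCaps f ≡ t
countCaps-caps {zero}  _     = refl
countCaps-caps {suc t} f≡cap = cong₂ _+_ (cong isCap (f≡cap zero)) (countCaps-caps (f≡cap ∘ suc))

module _ {a} {X : Set a} where

  keepIfCap : BinOp → X → List X → List X
  keepIfCap cap x xs = x ∷ xs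
  keepIfCap cup x xs = xs

  capsOf : ∀ {t} → (Fin t → BinOp) → (Fin t → X) → List X
  capsOf {zero}  o x = []
  capsOf {suc t} o x = keepIfCap (o zero) (x zero) (capsOf (o ∘ suc) (x ∘ suc))

  length-capsOf : ∀ {t} (o : Fin t → BinOp) (x : Fin t → X) → length (capsOf o x) ≡ countCaps o
  length-capsOf {zero}  o x = refl
  length-capsOf {suc t} o x with o zero
  ... | cap = cong suc (length-capsOf (o ∘ suc) (x ∘ suc))
  ... | cup = length-capsOf (o ∘ suc) (x ∘ suc)

  All-capsOf : ∀ {p} {P : X → Set p} {t} (o : Fin t → BinOp) {x : Fin t → X} →
               (∀ i → P (x i)) → All P (capsOf o x)
  All-capsOf {t = zero}  o Px = []
  All-capsOf {t = suc t} o Px with o zero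
  ... | cap = Px zero ∷ All-capsOf (o ∘ suc) (Px ∘ suc)
  ... | cup = All-capsOf (o ∘ suc) (Px ∘ suc)

  capsOf-∈ : ∀ {t} (o : Fin t → BinOp) (x : Fin t → X) i → o i ≡ cap → x i ∈ₗ capsOf o x
  capsOf-∈ o x zero    oi≡cap with o zero
  capsOf-∈ o x zero    refl | .cap = here refl
  capsOf-∈ o x (suc i) oi≡cap with o zero
  ... | cap = there (capsOf-∈ (o ∘ suc) (x ∘ suc) i oi≡cap)
  ... | cup = capsOf-∈ (o ∘ suc) (x ∘ suc) i oi≡cap

module Evaluation {n : ℕ} (𝓑 : List (Subset n)) {t : ℕ} (S : SynSeq t (length 𝓑)) where

  applyGate : (Fin t → Subset n) → Gate t (length 𝓑) → Subset n
  applyGate X (gate L o R) = applyOp o (operandValue 𝓑 X L) (operandValue 𝓑 X R)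

  ev : ℕ → Fin t → Subset n
  ev = eval 𝓑 S

  ∈-eval-ind : ∀ {x} (Q : Fin t → Set) →
               (∀ X i → (∀ k → x ∈ X k → Q k) → x ∈ applyGate X (S i) → Q i) →
               ∀ j i → x ∈ ev j i → Q i
  ∈-eval-ind Q step zero    i x∈ = contradiction x∈ ∉⊥
  ∈-eval-ind Q step (suc j) i x∈ =
    [ ∈-eval-ind Q step j i , step (ev j) i (∈-eval-ind Q step j) ]′ (x∈p∪q⁻ _ _ x∈)

  applyGate-cong : ∀ {X Y : Fin t → Subset n} → (∀ i → X i ≡ Y i) → ∀ g → applyGate X g ≡ applyGate Y g
  applyGate-cong {X} {Y} X≡Y (gate L o R) = cong₂ (applyOp o) (operand-cong L) (operand-cong R)
    where
    operand-cong : ∀ o → operandValue 𝓑 X o ≡ operandValue 𝓑 Y o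
    operand-cong (inj₁ k) = X≡Y k
    operand-cong (inj₂ b) = refl

  Stable : ℕ → Set
  Stable j = ∀ i → ev (suc j) i ≡ ev j i

  stable-+ : ∀ {J} → Stable J → ∀ d i → ev (d + J) i ≡ ev J i
  stable-+         stable zero    i = refl
  stable-+ {J = J} stable (suc d) i = begin
    ev (d + J) i ∪ applyGate (ev (d + J)) (S i) ≡⟨ cong₂ _∪_ (stable-+ stable d i)
                                                            (applyGate-cong (stable-+ stable d) (S i)) ⟩
    ev J i ∪ applyGate (ev J) (S i)             ≡⟨ stable i ⟩
    ev J i                                      ∎
    where open ≡-Reasoning

  size : ℕ → ℕ
  size j = sum (λ i → ∣ ev j i ∣)

  ev-⊆-suc : ∀ j i → ev j i ⊆ ev (suc j) i
  ev-⊆-suc j i = p⊆p∪q _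

  size-grows : ∀ j → ¬ Stable j → size j < size (suc j)
  size-grows j unstable with ¬∀⟶∃¬ t _ (λ i → ≡-dec _≟ᵇ_ (ev (suc j) i) (ev j i)) unstable
  ... | i , changed = sum-mono-< (λ k → p⊆q⇒∣p∣≤∣q∣ (ev-⊆-suc j k)) i
                                 (p⊂q⇒∣p∣<∣q∣ (⊆∧≢⇒⊂ (ev-⊆-suc j i) (changed ∘ sym)))

  -- Opaque so that the type checker never runs the search for the settling time.
  opaque
    eventually-stable : ∃ Stable
    eventually-stable = bounded-growth-halts (λ j → all? λ i → ≡-dec _≟ᵇ_ (ev (suc j) i) (ev j i))
                                             size (t * n) (λ j → sum-≤-* (λ i → ∣p∣≤n (ev j i))) size-grows

  settlingTime : ℕ
  settlingTime = proj₁ eventually-stable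

  limit : Fin t → Subset n
  limit = ev settlingTime

  ev-settles : ∀ j → settlingTime ≤ j → ∀ i → ev j i ≡ limit i
  ev-settles j settled i =
    subst (λ j → ev j i ≡ limit i) (m∸n+n≡m settled) (stable-+ (proj₂ eventually-stable) (j ∸ settlingTime) i)

  applyGate-limit-⊆ : ∀ i → applyGate limit (S i) ⊆ limit i
  applyGate-limit-⊆ i {x} x∈ = subst (x ∈_) (proj₂ eventually-stable i) (q⊆p∪q (limit i) _ x∈)

∩-monoˡ-⊆ : ∀ {n} {p q : Subset n} r → p ⊆ q → p ∩ r ⊆ q ∩ r
∩-monoˡ-⊆ {p = p} r p⊆q x∈ = let x∈p , x∈r = x∈p∩q⁻ p r x∈ in x∈p∩q⁺ (p⊆q x∈p , x∈r)

p∩r∩q∩r⊆p∩q∩r : ∀ {n} {p q r : Subset n} → (p ∩ r) ∩ (q ∩ r) ⊆ (p ∩ q) ∩ r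
p∩r∩q∩r⊆p∩q∩r {p = p} {q} {r} x∈ =
  let x∈p∩r , x∈q∩r = x∈p∩q⁻ (p ∩ r) (q ∩ r) x∈
      x∈p   , x∈r   = x∈p∩q⁻ p r x∈p∩r
  in x∈p∩q⁺ (x∈p∩q⁺ (x∈p , proj₁ (x∈p∩q⁻ q r x∈q∩r)) , x∈r)

module FromSequence {n : ℕ} (A : Subset n) (𝓑 : List (Subset n)) {s : ℕ} (S : SynSeq (suc s) (length 𝓑)) where

  open Evaluation 𝓑 S

  tracePair : Gate (suc s) (length 𝓑) → Subset n × Subset n
  tracePair (gate L _ R) = operandValue 𝓑 limit L ∩ U A , operandValue 𝓑 limit R ∩ U A

  Λ : List (Subset n × Subset n)
  Λ = capsOf (Gate.op ∘ S) (tracePair ∘ S)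

  module _ (𝓕 : Family n) (semiFilter : IsSemiFilter (U A) 𝓕) (preserves : Preserves 𝓕 Λ)
           (a : Fin n) (above : Above 𝓑 (U A) 𝓕 a) where

    open IsSemiFilter semiFilter

    Large : Subset n → Set
    Large X = 𝓕 (X ∩ U A) ≡ true

    large-mono : ∀ {X Y} → X ⊆ Y → Large X → Large Y
    large-mono {X} {Y} X⊆Y X-large = upward (X ∩ U A) (Y ∩ U A) X-large (∩-monoˡ-⊆ (U A) X⊆Y) (p∩q⊆q Y (U A))

    module _ {X : Fin (suc s) → Subset n} (ih : ∀ k → a ∈ X k → Large (limit k)) where

      large-operand : ∀ o → a ∈ operandValue 𝓑 X o → Large (operandValue 𝓑 limit o)
      large-operand (inj₁ k) = ih k
      large-operand (inj₂ b) = above (lookup 𝓑 b) (∈-lookup b)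

      large-gate : ∀ g → (Gate.op g ≡ cap → PreservesPair 𝓕 (tracePair g)) →
                   a ∈ applyGate X g → Large (applyGate limit g)
      large-gate (gate L cup R) _ a∈ =
        [ large-mono (p⊆p∪q _) ∘ large-operand L , large-mono (q⊆p∪q _ _) ∘ large-operand R ]′
          (x∈p∪q⁻ _ _ a∈)
      large-gate (gate L cap R) preserved a∈ with x∈p∩q⁻ _ _ a∈
      ... | a∈L , a∈R =
        upward _ _ (preserved refl (large-operand L a∈L) (large-operand R a∈R)) p∩r∩q∩r⊆p∩q∩r (p∩q⊆q _ _)

    preserves-caps : ∀ i → Gate.op (S i) ≡ cap → PreservesPair 𝓕 (tracePair (S i))
    preserves-caps i = All.lookup preserves ∘ capsOf-∈ (Gate.op ∘ S) (tracePair ∘ S) i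

    large-limit : ∀ i → a ∈ limit i → Large (limit i)
    large-limit = ∈-eval-ind (λ i → Large (limit i))
      (λ X i ih a∈ → large-mono (applyGate-limit-⊆ i) (large-gate ih (S i) (preserves-caps i) a∈))
      settlingTime

    not-above-A : limit (fromℕ s) ≡ A → a ∉ A
    not-above-A limit≡A a∈A = contradiction (trans (sym ∅-large) noEmpty) λ ()
      where
      open ≡-Reasoning
      ∅-large : 𝓕 ⊥ ≡ true
      ∅-large = begin
        𝓕 ⊥                       ≡⟨ cong 𝓕 (∩-inverseʳ A) ⟨
        𝓕 (A ∩ U A)               ≡⟨ cong (λ X → 𝓕 (X ∩ U A)) limit≡A ⟨
        𝓕 (limit (fromℕ s) ∩ U A) ≡⟨ large-limit (fromℕ s) (subst (a ∈_) (sym limit≡A) a∈A) ⟩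
        true                      ∎

  limit-output : Generates 𝓑 S A → limit (fromℕ s) ≡ A
  limit-output (j₀ , generates) =
    trans (sym (ev-settles (j₀ + settlingTime) (m≤n+m settlingTime j₀) (fromℕ s)))
          (generates _ (m≤m+n j₀ settlingTime))

  rhoAtMost : Generates 𝓑 S A → RhoAtMost A 𝓑 (capCount S)
  rhoAtMost generates =
    Λ , ≤-reflexive (length-capsOf (Gate.op ∘ S) (tracePair ∘ S)) ,
    All-capsOf (Gate.op ∘ S) {tracePair ∘ S} (λ _ → p∩q⊆q _ (U A) , p∩q⊆q _ (U A)) ,
    λ 𝓕 semiFilter preserves a a∈A above → not-above-A 𝓕 semiFilter preserves a above (limit-output generates) a∈A

module FromCover {n : ℕ} (A : Subset n) (A≢⊤ : A ≢ ⊤) (𝓑 : List (Subset n)) (Λ : List (Subset n × Subset n))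
                 (Λ-witness : IsRhoWitness A 𝓑 Λ) where

  m K M C s : ℕ
  m = length 𝓑
  K = length Λ
  M = m + K
  C = suc (K + K)
  s = C * suc M + K

  E H : Fin K → Subset n
  E l = proj₁ (lookup Λ l)
  H l = proj₂ (lookup Λ l)

  E⊆U : ∀ l → E l ⊆ U A
  E⊆U l = proj₁ (All.lookup (proj₁ Λ-witness) (∈-lookup l))

  H⊆U : ∀ l → H l ⊆ U A
  H⊆U l = proj₂ (All.lookup (proj₁ Λ-witness) (∈-lookup l))

  E∩H⊆U : ∀ l → E l ∩ H l ⊆ U A
  E∩H⊆U l = E⊆U l ∘ proj₁ ∘ x∈p∩q⁻ (E l) (H l)

  data Target : Set where
    empty       : Target
    fstOf sndOf : Fin K → Target

  target : Target → Subset n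
  target empty     = ⊥
  target (fstOf l) = E l
  target (sndOf l) = H l

  data Node : Set where
    chain  : Target → Fin (suc M) → Node
    meet   : Fin K → Node
    output : Node

  encodeTarget : Target → Fin C
  encodeTarget empty     = zero
  encodeTarget (fstOf l) = suc (l ↑ˡ K)
  encodeTarget (sndOf l) = suc (K ↑ʳ l)

  decodeTarget : Fin C → Target
  decodeTarget zero    = empty
  decodeTarget (suc x) = [ fstOf , sndOf ]′ (splitAt K x)

  decode-encodeTarget : ∀ c → decodeTarget (encodeTarget c) ≡ c
  decode-encodeTarget empty     = refl
  decode-encodeTarget (fstOf l) = cong [ fstOf , sndOf ]′ (splitAt-↑ˡ K l K)
  decode-encodeTarget (sndOf l) = cong [ fstOf , sndOf ]′ (splitAt-↑ʳ K K l)

  -- Chains first, then meets; `Generates` reads the output from the last symbol.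
  encode : Node → Fin (suc s)
  encode (chain c p) = inject₁ (combine (encodeTarget c) p ↑ˡ K)
  encode (meet l)    = inject₁ (C * suc M ↑ʳ l)
  encode output      = fromℕ s

  chainAt : Fin C × Fin (suc M) → Node
  chainAt (c , p) = chain (decodeTarget c) p

  decodeInner : Fin (C * suc M) ⊎ Fin K → Node
  decodeInner (inj₁ r) = chainAt (remQuot (suc M) r)
  decodeInner (inj₂ l) = meet l

  decodeView : ∀ {i : Fin (suc s)} → View i → Node
  decodeView ‵fromℕ       = output
  decodeView (‵inject₁ j) = decodeInner (splitAt (C * suc M) j)

  decode : Fin (suc s) → Node
  decode i = decodeView (view i)

  decode-inject₁ : ∀ j → decode (inject₁ j) ≡ decodeInner (splitAt (C * suc M) j)
  decode-inject₁ j = cong decodeView (view-inject₁ j)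

  decode-encode : ∀ x → decode (encode x) ≡ x
  decode-encode (chain c p) = begin
    decode (inject₁ (r ↑ˡ K))              ≡⟨ decode-inject₁ (r ↑ˡ K) ⟩
    decodeInner (splitAt (C * suc M) (r ↑ˡ K)) ≡⟨ cong decodeInner (splitAt-↑ˡ (C * suc M) r K) ⟩
    chainAt (remQuot (suc M) r)            ≡⟨ cong chainAt (remQuot-combine (encodeTarget c) p) ⟩
    chain (decodeTarget (encodeTarget c)) p ≡⟨ cong (λ c → chain c p) (decode-encodeTarget c) ⟩
    chain c p                              ∎
    where
    open ≡-Reasoning
    r : Fin (C * suc M)
    r = combine (encodeTarget c) p
  decode-encode (meet l) = trans (decode-inject₁ _) (cong decodeInner (splitAt-↑ʳ (C * suc M) K l))
  decode-encode output   = cong decodeView (view-fromℕ s)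

  Operand : Set
  Operand = Fin (suc s) ⊎ Fin m

  node : Node → Operand
  node x = inj₁ (encode x)

  source : Fin M → Operand
  source q = [ inj₂ , node ∘ meet ]′ (splitAt m q)

  trace : Fin M → Subset n
  trace q = [ (λ b → lookup 𝓑 b ∩ U A) , (λ l → E l ∩ H l) ]′ (splitAt m q)

  source-↑ˡ : ∀ b → source (b ↑ˡ K) ≡ inj₂ b
  source-↑ˡ b = cong [ inj₂ , node ∘ meet ]′ (splitAt-↑ˡ m b K)

  trace-↑ˡ : ∀ b → trace (b ↑ˡ K) ≡ lookup 𝓑 b ∩ U A
  trace-↑ˡ b = cong [ (λ b → lookup 𝓑 b ∩ U A) , (λ l → E l ∩ H l) ]′ (splitAt-↑ˡ m b K)

  source-↑ʳ : ∀ l → source (m ↑ʳ l) ≡ node (meet l)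
  source-↑ʳ l = cong [ inj₂ , node ∘ meet ]′ (splitAt-↑ʳ m K l)

  trace-↑ʳ : ∀ l → trace (m ↑ʳ l) ≡ E l ∩ H l
  trace-↑ʳ l = cong [ (λ b → lookup 𝓑 b ∩ U A) , (λ l → E l ∩ H l) ]′ (splitAt-↑ʳ m K l)

  top : Fin (suc M)
  top = fromℕ M

  entry : Target → Fin M → Operand
  entry c q with trace q ⊆? target c
  ... | yes _ = source q
  ... | no  _ = node (chain c (suc q))

  -- A source whose trace is not inside the target is replaced by the gate itself, a no-op under ∪;
  -- for the same reason the base of each chain stays empty.
  gateOf : Node → Gate (suc s) m
  gateOf (chain c zero)    = gate (node (chain c zero)) cup (node (chain c zero))
  gateOf (chain c (suc q)) = gate (entry c q) cup (node (chain c (inject₁ q)))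
  gateOf (meet l)          = gate (node (chain (fstOf l) top)) cap (node (chain (sndOf l) top))
  gateOf output            = gate (node (chain empty top)) cup (node (chain empty top))

  network : SynSeq (suc s) m
  network = gateOf ∘ decode

  chainAt-cup : ∀ cp → Gate.op (gateOf (chainAt cp)) ≡ cup
  chainAt-cup (_ , zero)  = refl
  chainAt-cup (_ , suc _) = refl

  capCount-network : capCount network ≡ K
  capCount-network = begin
    countCaps ops                                            ≡⟨ countCaps-init-last ops ⟩
    countCaps (ops ∘ inject₁) + isCap (ops (fromℕ s))       ≡⟨ cong₂ _+_ (countCaps-++ (C * suc M) (ops ∘ inject₁))
                                                                          (cong (isCap ∘ Gate.op ∘ gateOf) (decode-encode output)) ⟩
    countCaps (ops ∘ chainIx) + countCaps (ops ∘ meetIx) + 0 ≡⟨ cong (_+ 0) (cong₂ _+_ (countCaps-cups chain-cup)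
                                                                                      (countCaps-caps meet-cap)) ⟩
    K + 0                                                    ≡⟨ +-identityʳ K ⟩
    K                                                        ∎
    where
    open ≡-Reasoning
    ops : Fin (suc s) → BinOp
    ops = Gate.op ∘ network
    chainIx : Fin (C * suc M) → Fin (suc s)
    chainIx r = inject₁ (r ↑ˡ K)
    meetIx : Fin K → Fin (suc s)
    meetIx l = inject₁ (C * suc M ↑ʳ l)
    chain-cup : ∀ r → ops (chainIx r) ≡ cup
    chain-cup r =
      trans (cong (Gate.op ∘ gateOf) (trans (decode-inject₁ (r ↑ˡ K)) (cong decodeInner (splitAt-↑ˡ _ r K))))
            (chainAt-cup (remQuot (suc M) r))
    meet-cap : ∀ l → ops (meetIx l) ≡ cap
    meet-cap l = cong (Gate.op ∘ gateOf) (decode-encode (meet l))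

  open Evaluation 𝓑 network

  value : Node → Subset n
  value x = limit (encode x)

  applyGate-⊆-value : ∀ x → applyGate limit (gateOf x) ⊆ value x
  applyGate-⊆-value x =
    subst (λ y → applyGate limit (gateOf y) ⊆ value x) (decode-encode x) (applyGate-limit-⊆ (encode x))

  bound : Node → Subset n
  bound (chain c _) = target c
  bound (meet l)    = E l ∩ H l
  bound output      = ⊥

  operandBound : Operand → Subset n
  operandBound (inj₁ i) = bound (decode i)
  operandBound (inj₂ b) = lookup 𝓑 b

  module _ {w : Fin n} (w∈U : w ∈ U A) where

    node-bound : ∀ x → w ∈ operandBound (node x) → w ∈ bound x
    node-bound x = subst (λ y → w ∈ bound y) (decode-encode x)

    source-bound : ∀ q → w ∈ operandBound (source q) → w ∈ trace q
    source-bound q with splitAt m q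
    ... | inj₁ b = λ w∈B → x∈p∩q⁺ (w∈B , w∈U)
    ... | inj₂ l = node-bound (meet l)

    entry-bound : ∀ c q → w ∈ operandBound (entry c q) → w ∈ target c
    entry-bound c q with trace q ⊆? target c
    ... | yes trace⊆ = trace⊆ ∘ source-bound q
    ... | no  _      = node-bound (chain c (suc q))

    module _ {X : Fin (suc s) → Subset n} (ih : ∀ k → w ∈ X k → w ∈ bound (decode k)) where

      operand-bound : ∀ o → w ∈ operandValue 𝓑 X o → w ∈ operandBound o
      operand-bound (inj₁ k) = ih k
      operand-bound (inj₂ b) = id

      node-operand-bound : ∀ x → w ∈ operandValue 𝓑 X (node x) → w ∈ bound x
      node-operand-bound x = node-bound x ∘ operand-bound (node x)

      gate-bound : ∀ x → w ∈ applyGate X (gateOf x) → w ∈ bound x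
      gate-bound (chain c zero) w∈ =
        [ node-operand-bound (chain c zero) , node-operand-bound (chain c zero) ]′ (x∈p∪q⁻ _ _ w∈)
      gate-bound (chain c (suc q)) w∈ =
        [ entry-bound c q ∘ operand-bound (entry c q) , node-operand-bound (chain c (inject₁ q)) ]′
          (x∈p∪q⁻ _ _ w∈)
      gate-bound (meet l) w∈ with x∈p∩q⁻ _ _ w∈
      ... | w∈E , w∈H =
        x∈p∩q⁺ (node-operand-bound (chain (fstOf l) top) w∈E , node-operand-bound (chain (sndOf l) top) w∈H)
      gate-bound output w∈ =
        [ node-operand-bound (chain empty top) , node-operand-bound (chain empty top) ]′ (x∈p∪q⁻ _ _ w∈)

    value-bound : ∀ x → w ∈ value x → w ∈ bound x
    value-bound x = node-bound x ∘ ∈-eval-ind (λ i → w ∈ bound (decode i)) (λ X i ih → gate-bound ih (decode i))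
                                              settlingTime (encode x)

  value-output-⊆ : value output ⊆ A
  value-output-⊆ {w} w∈ = decidable-stable (w ∈? A) (λ w∉A → ∉⊥ (value-bound (x∉p⇒x∈∁p w∉A) output w∈))

  chain-⊆-top : ∀ c p → value (chain c p) ⊆ value (chain c top)
  chain-⊆-top c = stepwise-≼-last {_≼_ = _⊆_} ⊆-refl ⊆-trans (value ∘ chain c)
                                   (λ q → applyGate-⊆-value (chain c (suc q)) ∘ q⊆p∪q _ _)

  entry-enabled : ∀ c q → trace q ⊆ target c → entry c q ≡ source q
  entry-enabled c q trace⊆ with trace q ⊆? target c
  ... | yes _       = refl
  ... | no  ¬trace⊆ = contradiction (λ {x} → trace⊆ {x}) ¬trace⊆

  source-⊆-chain : ∀ c q → trace q ⊆ target c → operandValue 𝓑 limit (source q) ⊆ value (chain c top)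
  source-⊆-chain c q trace⊆ {x} x∈ =
    chain-⊆-top c (suc q) (applyGate-⊆-value (chain c (suc q))
      (p⊆p∪q _ (subst (λ o → x ∈ operandValue 𝓑 limit o) (sym (entry-enabled c q trace⊆)) x∈)))

  U≢⊥ : U A ≢ ⊥
  U≢⊥ U≡⊥ = A≢⊤ (⊆-antisym ⊆⊤ (λ {x} _ → x∉∁p⇒x∈p (λ x∈U → ∉⊥ (subst (x ∈_) U≡⊥ x∈U))))

  module Filter (a : Fin n) (a∉ : a ∉ value (chain empty top)) where

    InFilter : Subset n → Set
    InFilter X = X ⊆ U A × (X ≡ U A ⊎ ∃[ q ] a ∈ operandValue 𝓑 limit (source q) × trace q ⊆ X)

    inFilter? : ∀ X → Dec (InFilter X)
    inFilter? X = X ⊆? U A ×-dec (≡-dec _≟ᵇ_ X (U A) ⊎-dec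
                    any? (λ q → a ∈? operandValue 𝓑 limit (source q) ×-dec trace q ⊆? X))

    𝓕 : Family n
    𝓕 X = does (inFilter? X)

    𝓕-intro : ∀ {X} → InFilter X → 𝓕 X ≡ true
    𝓕-intro = dec-true (inFilter? _)

    𝓕-elim : ∀ {X} → 𝓕 X ≡ true → InFilter X
    𝓕-elim {X} X∈𝓕 = invert (subst (Reflects (InFilter X)) X∈𝓕 (proof (inFilter? X)))

    inFilter-up : ∀ {X Y} → InFilter X → X ⊆ Y → Y ⊆ U A → InFilter Y
    inFilter-up (_ , inj₁ refl)                  X⊆Y Y⊆U = Y⊆U , inj₁ (⊆-antisym Y⊆U X⊆Y)
    inFilter-up (_ , inj₂ (q , a∈source , trace⊆)) X⊆Y Y⊆U = Y⊆U , inj₂ (q , a∈source , X⊆Y ∘ trace⊆)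

    target-inFilter : ∀ c → InFilter (target c) → target c ≡ U A ⊎ a ∈ value (chain c top)
    target-inFilter c (_ , inj₁ c≡U)                   = inj₁ c≡U
    target-inFilter c (_ , inj₂ (q , a∈source , trace⊆)) = inj₂ (source-⊆-chain c q trace⊆ a∈source)

    ∅-notInFilter : ¬ InFilter ⊥
    ∅-notInFilter = [ U≢⊥ ∘ sym , a∉ ]′ ∘ target-inFilter empty

    isSemiFilter : IsSemiFilter (U A) 𝓕
    isSemiFilter = record
      { within   = λ _ → proj₁ ∘ 𝓕-elim
      ; nonempty = U A , 𝓕-intro (⊆-refl , inj₁ refl)
      ; noEmpty  = dec-false (inFilter? ⊥) ∅-notInFilter
      ; upward   = λ _ _ X∈𝓕 X⊆Y Y⊆U → 𝓕-intro (inFilter-up (𝓕-elim X∈𝓕) X⊆Y Y⊆U)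
      }

    meet-inFilter : ∀ l → InFilter (E l) → InFilter (H l) → InFilter (E l ∩ H l)
    meet-inFilter l E∈ H∈ with target-inFilter (fstOf l) E∈ | target-inFilter (sndOf l) H∈
    ... | inj₁ E≡U | _ =
      inFilter-up H∈ (λ {x} x∈H → x∈p∩q⁺ (subst (x ∈_) (sym E≡U) (H⊆U l x∈H) , x∈H)) (E∩H⊆U l)
    ... | inj₂ _ | inj₁ H≡U =
      inFilter-up E∈ (λ {x} x∈E → x∈p∩q⁺ (x∈E , subst (x ∈_) (sym H≡U) (E⊆U l x∈E))) (E∩H⊆U l)
    ... | inj₂ a∈E | inj₂ a∈H =
      E∩H⊆U l , inj₂ (m ↑ʳ l , subst (λ o → a ∈ operandValue 𝓑 limit o) (sym (source-↑ʳ l))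
                                     (applyGate-⊆-value (meet l) (x∈p∩q⁺ (a∈E , a∈H))) ,
                      ⊆-reflexive (trace-↑ʳ l))

    preserves : Preserves 𝓕 Λ
    preserves = All.tabulate λ p∈Λ →
      subst (PreservesPair 𝓕) (sym (lookup-index p∈Λ))
            (λ E∈𝓕 H∈𝓕 → 𝓕-intro (meet-inFilter (index p∈Λ) (𝓕-elim E∈𝓕) (𝓕-elim H∈𝓕)))

    above : Above 𝓑 (U A) 𝓕 a
    above B B∈𝓑 a∈B = 𝓕-intro (p∩q⊆q B (U A) , inj₂ (b ↑ˡ K , a∈source , ⊆-reflexive trace≡))
      where
      b : Fin m
      b = index B∈𝓑
      B≡ : B ≡ lookup 𝓑 b
      B≡ = lookup-index B∈𝓑
      a∈source : a ∈ operandValue 𝓑 limit (source (b ↑ˡ K))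
      a∈source = subst (λ o → a ∈ operandValue 𝓑 limit o) (sym (source-↑ˡ b)) (subst (a ∈_) B≡ a∈B)
      trace≡ : trace (b ↑ˡ K) ≡ B ∩ U A
      trace≡ = trans (trace-↑ˡ b) (cong (_∩ U A) (sym B≡))

  A-⊆-chain : A ⊆ value (chain empty top)
  A-⊆-chain {a} a∈A = decidable-stable (a ∈? value (chain empty top)) λ a∉ →
    let open Filter a a∉ in proj₂ Λ-witness 𝓕 isSemiFilter preserves a a∈A above

  value-output : value output ≡ A
  value-output = ⊆-antisym value-output-⊆ (λ a∈A → applyGate-⊆-value output (p⊆p∪q _ (A-⊆-chain a∈A)))

  dcapAtMost : DcapAtMost A 𝓑 K
  dcapAtMost = s , network , ≤-reflexive capCount-network ,
               settlingTime , λ j settled → trans (ev-settles j settled (fromℕ s)) value-output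

RhoAtMost-mono : ∀ {n} {A : Subset n} {𝓑 k k′} → k ≤ k′ → RhoAtMost A 𝓑 k → RhoAtMost A 𝓑 k′
RhoAtMost-mono k≤k′ (Λ , Λ≤k , witness) = Λ , ≤-trans Λ≤k k≤k′ , witness

DcapAtMost-mono : ∀ {n} {A : Subset n} {𝓑 k k′} → k ≤ k′ → DcapAtMost A 𝓑 k → DcapAtMost A 𝓑 k′
DcapAtMost-mono k≤k′ (s , S , caps≤k , generates) = s , S , ≤-trans caps≤k k≤k′ , generates

theorem1p3 : ∀ (n : ℕ) → 0 < n → (A : Subset n) → A ≢ ⊥ → A ≢ ⊤ →
    (𝓑 : List (Subset n)) → 𝓑 ≢ [] →
    ∀ (k : ℕ) → RhoAtMost A 𝓑 k ⇔ DcapAtMost A 𝓑 k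
theorem1p3 n _ A _ A≢⊤ 𝓑 _ k = mk⇔
  (λ (Λ , Λ≤k , witness) → DcapAtMost-mono Λ≤k (FromCover.dcapAtMost A A≢⊤ 𝓑 Λ witness))
  (λ (_ , S , caps≤k , generates) → RhoAtMost-mono caps≤k (FromSequence.rhoAtMost A 𝓑 S generates))
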